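{- There is a set $A \subseteq \mathbb{N}$ that contains no arithmetic progression of length three and such that the ratio set $R(A) = \{a/a' : a,a' \in A\}$ is dense in $\mathbb{Q}_p$ for every prime $p$.
   Context: $\mathbb{N} = \{1,2,\ldots\}$; $\mathbb{Q}_p$ denotes the field of $p$-adic numbers with the $p$-adic metric. -}

module Defs where

open import Data.Nat using (ℕ; zero; suc; _+_; _*_; _^_; _≤_)
open import Data.Nat.Divisibility using (_∣_)
open import Data.Nat.Primality using (Prime)
open import Data.Integer using (+_; ∣_∣)
open import Data.Rational using (ℚ; _/_; _-_; ↥_)
open import Data.Product using (Σ; ∃; _×_; _,_)
open import Relation.Binary.PropositionalEquality using (_≡_)

Subset : Set₁
Subset = ℕ → Set

PositiveSet : Subset → Set
PositiveSet A = ∀ n → A n → 1 ≤ n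

No3AP : Subset → Set
No3AP A = ∀ a b c → A a → A b → A c → a + c ≡ 2 * b → a ≡ c

-- Ratio set R(A) = { a / a' : a, a' ∈ A } ⊆ ℚ (a' written as suc m, since A ⊆ {1,2,...}).
RatioSet : Subset → ℚ → Set
RatioSet A q = Σ ℕ λ a → Σ ℕ λ m → A a × A (suc m) × (q ≡ (+ a) / suc m)

-- p-adic closeness on ℚ: |x - y|_p ≤ p^(-k).
-- For a normalised rational r = n/d (gcd(n,d)=1), |r|_p ≤ p^(-k) (k ≥ 0) iff p^k ∣ n
-- (this also covers r = 0, whose numerator is 0).
PAdicClose : ℕ → ℕ → ℚ → ℚ → Set
PAdicClose p k x y = (p ^ k) ∣ ∣ ↥ (x - y) ∣

-- Since ℚ is dense in ℚ_p and the balls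
-- {|z - x|_p ≤ p^(-k)} (k ∈ ℕ) form a neighbourhood base, this is equivalent to:
-- every rational x is approximated p-adically arbitrarily well by elements of S.
DenseInQp : ℕ → (ℚ → Set) → Set
DenseInQp p S = ∀ (x : ℚ) (k : ℕ) → Σ ℚ λ s → S s × PAdicClose p k s x

{-# OPTIONS --safe #-}
-- List the fractions c/d with 2 d ≤ c as c_i / d_i and let A consist of the numbers d_i t_i
-- and c_i t_i, where t_0 = 1 and t_(i+1) = 2 c_i t_i.  In the order d_0 t_0, c_0 t_0, d_1 t_1, …
-- every element is at least twice the previous one, and in such a lacunary set a + c = 2 b
-- forces a = c: if a < c then b < c, so 2 b ≤ c < a + c.  The ratio set contains every
-- c_i / d_i, i.e. every rational ≥ 2, and a rational x = n / d is approximated to p-adic order k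
-- by x + K p^k = (n + K p^k d) / d, which is ≥ 2 for a suitable integer K.
module Submission where

open import Defs
open import Data.Nat using (ℕ)
open import Data.Nat.Primality using (Prime)
open import Data.Product using (Σ; _×_)

open import Function using (_∘_; id)
open import Data.Nat as ℕ
  using (zero; suc; _+_; _*_; _^_; _≤_; _<_; NonZero; >-nonZero⁻¹; _≤′_; ≤′-refl; ≤′-step)
open import Data.Nat.Properties
  using (≤-refl; ≤-trans; ≤-antisym; m≤m+n; m≤n*m; m<n+m; *-monoˡ-≤; +-monoˡ-<; *-cancelˡ-<;
         <⇒≱; ≰⇒>; ≮⇒≥; <-irrefl; ≤⇒≤′; +-comm; +-suc; +-identityʳ; *-assoc; *-comm; *-identityʳ;
         suc-injective; m*n≢0; m^n≢0; module ≤-Reasoning)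
open import Data.Nat.Divisibility using (_∣_; n∣m*n)
open import Data.Nat.Primality using (prime⇒nonZero)
open import Data.Integer as ℤ using (ℤ; +_; ∣_∣)
open import Data.Integer.Properties as ℤ using (pos-+; pos-*; abs-*)
open import Data.Integer.DivMod using (_%ℕ_; _/ℕ_; a≡a%ℕn+[a/ℕn]*n)
open import Data.Integer.Tactic.RingSolver using (solve-∀)
open import Data.Rational as ℚ using (ℚ; mkℚ; _/_; ↥_; ↧_; ↧ₙ_)
open import Data.Rational.Literals using (fromℤ)
open import Data.Rational.Unnormalised using (mkℚᵘ; *≡*)
open import Data.Rational.Properties using (/-cong; fromℚᵘ-cong; +-0-abelianGroup)
open import Algebra.Properties.AbelianGroup +-0-abelianGroup using (xyx⁻¹≈y)
open import Data.Product using (∃; _,_; proj₁; proj₂; map)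
open import Relation.Binary.PropositionalEquality

diagonal-next : ℕ × ℕ → ℕ × ℕ
diagonal-next (x , zero)  = zero , suc x
diagonal-next (x , suc y) = suc x , y

diagonal : ℕ → ℕ × ℕ
diagonal zero    = 0 , 0
diagonal (suc i) = diagonal-next (diagonal i)

diagonal-surjective : ∀ u → ∃ λ i → diagonal i ≡ u
diagonal-surjective (x , y) = reach (x + y) x y refl
  where
  reach : ∀ s x y → x + y ≡ s → ∃ λ i → diagonal i ≡ (x , y)
  reach zero    zero    zero    _  = 0 , refl
  reach zero    zero    (suc y) ()
  reach (suc s) zero    zero    ()
  reach s       (suc x) y       xy =
    map suc (cong diagonal-next) (reach s x (suc y) (trans (+-suc x y) xy))
  reach (suc s) zero    (suc y) xy =
    map suc (cong diagonal-next) (reach s y zero (trans (+-identityʳ y) (suc-injective xy)))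

Image : (ℕ → ℕ) → Subset
Image w n = ∃ λ j → w j ≡ n

module Lacunary (w : ℕ → ℕ) (w-pos : ∀ j → 1 ≤ w j) (w-double : ∀ j → 2 * w j ≤ w (suc j))
  where

  mono-≤′ : ∀ {j k} → j ≤′ k → w j ≤ w k
  mono-≤′ ≤′-refl           = ≤-refl
  mono-≤′ (≤′-step {k} j≤k) =
    ≤-trans (mono-≤′ j≤k) (≤-trans (m≤m+n (w k) (w k + 0)) (w-double k))

  mono-≤ : ∀ {j k} → j ≤ k → w j ≤ w k
  mono-≤ = mono-≤′ ∘ ≤⇒≤′

  cancel-< : ∀ {j k} → w j < w k → j < k
  cancel-< wj<wk = ≰⇒> λ k≤j → <⇒≱ wj<wk (mono-≤ k≤j)

  double-< : ∀ {j k} → j < k → 2 * w j ≤ w k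
  double-< {j} j<k = ≤-trans (w-double j) (mono-≤ j<k)

  -- If w j < w l then the midpoint w k is below w l, hence at most w l / 2 < (w j + w l) / 2.
  right-end-≤ : ∀ {j k l} → w j + w l ≡ 2 * w k → w l ≤ w j
  right-end-≤ {j} {k} {l} ap = ≮⇒≥ λ wj<wl → <-irrefl refl (begin-strict
      2 * w k   ≤⟨ double-< (k<l wj<wl) ⟩
      w l       <⟨ m<n+m (w l) (w-pos j) ⟩
      w j + w l ≡⟨ ap ⟩
      2 * w k   ∎)
    where
    open ≤-Reasoning
    k<l : w j < w l → k < l
    k<l wj<wl = cancel-< (*-cancelˡ-< 2 (w k) (w l) (begin-strict
      2 * w k       ≡⟨ ap ⟨
      w j + w l     <⟨ +-monoˡ-< (w l) wj<wl ⟩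
      w l + w l     ≡⟨ cong (λ t → w l + t) (+-identityʳ (w l)) ⟨
      2 * w l       ∎))

  image-positive : PositiveSet (Image w)
  image-positive _ (j , refl) = w-pos j

  image-no3AP : No3AP (Image w)
  image-no3AP _ _ _ (j , refl) (k , refl) (l , refl) ap =
    ≤-antisym (right-end-≤ {l} {k} {j} (trans (+-comm (w l) (w j)) ap)) (right-end-≤ ap)

interleave : (ℕ → ℕ) → (ℕ → ℕ) → ℕ → ℕ
interleave f g zero          = f zero
interleave f g (suc zero)    = g zero
interleave f g (suc (suc n)) = interleave (f ∘ suc) (g ∘ suc) n

interleave-all : ∀ {P : ℕ → Set} {f g} → (∀ i → P (f i)) → (∀ i → P (g i)) →
                 ∀ n → P (interleave f g n)
interleave-all Pf Pg zero          = Pf zero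
interleave-all Pf Pg (suc zero)    = Pg zero
interleave-all {P} {f} {g} Pf Pg (suc (suc n)) =
  interleave-all {P} {f ∘ suc} {g ∘ suc} (Pf ∘ suc) (Pg ∘ suc) n

interleave-chain : ∀ {R : ℕ → ℕ → Set} {f g} →
                   (∀ i → R (f i) (g i)) → (∀ i → R (g i) (f (suc i))) →
                   ∀ n → R (interleave f g n) (interleave f g (suc n))
interleave-chain Rfg Rgf zero          = Rfg zero
interleave-chain Rfg Rgf (suc zero)    = Rgf zero
interleave-chain {R} {f} {g} Rfg Rgf (suc (suc n)) =
  interleave-chain {R} {f ∘ suc} {g ∘ suc} (Rfg ∘ suc) (Rgf ∘ suc) n

interleave-left : ∀ f g i → Image (interleave f g) (f i)
interleave-left f g zero    = 0 , refl
interleave-left f g (suc i) = map (suc ∘ suc) id (interleave-left (f ∘ suc) (g ∘ suc) i)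

interleave-right : ∀ f g i → Image (interleave f g) (g i)
interleave-right f g zero    = 1 , refl
interleave-right f g (suc i) = map (suc ∘ suc) id (interleave-right (f ∘ suc) (g ∘ suc) i)

ratio∈RatioSet : ∀ {A : Subset} {a b} .{{_ : NonZero b}} → A a → A b → RatioSet A ((+ a) / b)
ratio∈RatioSet {b = suc m} a∈A b∈A = _ , m , a∈A , b∈A , refl

+[a*c]/[b*c]≡+a/b : ∀ a b c .{{_ : NonZero b}} .{{_ : NonZero c}} →
                    _/_ (+ (a * c)) (b * c) {{m*n≢0 b c}} ≡ (+ a) / b
+[a*c]/[b*c]≡+a/b a b@(suc b-1) c@(suc _) =
  fromℚᵘ-cong {mkℚᵘ (+ (a * c)) (ℕ.pred (b * c))} {mkℚᵘ (+ a) b-1} (*≡* (begin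
  + (a * c) ℤ.* + b ≡⟨ pos-* (a * c) b ⟨
  + (a * c * b)     ≡⟨ cong +_ (trans (*-assoc a c b) (cong (a *_) (*-comm c b))) ⟩
  + (a * (b * c))   ≡⟨ pos-* a (b * c) ⟩
  + a ℤ.* + (b * c) ∎))
  where open ≡-Reasoning

-- (δ , y) ↦ (2 d + y) / d with d = 1 + δ maps ℕ × ℕ onto ℚ ∩ [2, ∞).
fraction≥2 : ℕ × ℕ → ℚ
fraction≥2 u = (+ (2 * suc (proj₁ u) + proj₂ u)) / suc (proj₁ u)

AllFractions≥2 : (ℚ → Set) → Set
AllFractions≥2 S = ∀ u → S (fraction≥2 u)

module Scaling (q : ℕ → ℕ × ℕ) where

  den num : ℕ → ℕ
  den i = suc (proj₁ (q i))
  num i = 2 * den i + proj₂ (q i)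

  scale : ℕ → ℕ
  scale zero    = 1
  scale (suc i) = 2 * (num i * scale i)

  scale-nonZero : ∀ i → NonZero (scale i)
  scale-nonZero zero    = _
  scale-nonZero (suc i) =
    m*n≢0 2 (num i * scale i) {{_}} {{m*n≢0 (num i) (scale i) {{_}} {{scale-nonZero i}}}}

  lower upper : ℕ → ℕ
  lower i = den i * scale i
  upper i = num i * scale i

  lower-nonZero : ∀ i → NonZero (lower i)
  lower-nonZero i = m*n≢0 (den i) (scale i) {{_}} {{scale-nonZero i}}

  upper-nonZero : ∀ i → NonZero (upper i)
  upper-nonZero i = m*n≢0 (num i) (scale i) {{_}} {{scale-nonZero i}}

  A : Subset
  A = Image (interleave lower upper)

  lower-double : ∀ i → 2 * lower i ≤ upper i
  lower-double i = subst (_≤ upper i) (*-assoc 2 (den i) (scale i))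
    (*-monoˡ-≤ (scale i) (m≤m+n (2 * den i) (proj₂ (q i))))

  upper-double : ∀ i → 2 * upper i ≤ lower (suc i)
  upper-double i = m≤n*m (2 * upper i) (den (suc i))

  open Lacunary (interleave lower upper)
    (λ n → >-nonZero⁻¹ _ {{interleave-all {NonZero} {lower} {upper} lower-nonZero upper-nonZero n}})
    (interleave-chain {λ a b → 2 * a ≤ b} {lower} {upper} lower-double upper-double)
    public using (image-positive; image-no3AP)

  fraction∈RatioSet : ∀ i → RatioSet A (fraction≥2 (q i))
  fraction∈RatioSet i =
    subst (RatioSet A) (+[a*c]/[b*c]≡+a/b (num i) (den i) (scale i) {{_}} {{scale-nonZero i}})
      (ratio∈RatioSet {{lower-nonZero i}} (interleave-right lower upper i) (interleave-left lower upper i))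

  ratioSet-allFractions≥2 : (∀ u → ∃ λ i → q i ≡ u) → AllFractions≥2 (RatioSet A)
  ratioSet-allFractions≥2 q-surjective u =
    let i , qi≡u = q-surjective u in subst (RatioSet A ∘ fraction≥2) qi≡u (fraction∈RatioSet i)

representative-≥ : ∀ (a : ℤ) b M .{{_ : NonZero M}} →
                   Σ ℕ λ y → Σ ℤ λ Q → + (b + y) ≡ a ℤ.+ Q ℤ.* + M
representative-≥ a b M = y , ℤ.- R , (begin
  + (b + y)                                  ≡⟨ pos-+ b y ⟩
  + b ℤ.+ + y                                ≡⟨ regroup (+ b) (+ y) R (+ M) ⟩
  + b ℤ.+ (+ y ℤ.+ R ℤ.* + M) ℤ.- R ℤ.* + M  ≡⟨ cong (λ t → + b ℤ.+ t ℤ.- R ℤ.* + M)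
                                                    (a≡a%ℕn+[a/ℕn]*n r M) ⟨
  + b ℤ.+ (a ℤ.- + b) ℤ.- R ℤ.* + M          ≡⟨ cancel a (+ b) R (+ M) ⟩
  a ℤ.+ ℤ.- R ℤ.* + M                        ∎)
  where
  open ≡-Reasoning
  r = a ℤ.- + b
  y = r %ℕ M
  R = r /ℕ M
  regroup : ∀ b y R M → b ℤ.+ y ≡ b ℤ.+ (y ℤ.+ R ℤ.* M) ℤ.- R ℤ.* M
  regroup = solve-∀
  cancel : ∀ a b R M → b ℤ.+ (a ℤ.- b) ℤ.- R ℤ.* M ≡ a ℤ.+ ℤ.- R ℤ.* M
  cancel = solve-∀

+-fromℤ : ∀ x k → x ℚ.+ fromℤ k ≡ (↥ x ℤ.+ k ℤ.* ↧ x) / ↧ₙ x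
+-fromℤ x@(mkℚ n _ _) k =
  /-cong (cong (ℤ._+ k ℤ.* ↧ x) (ℤ.*-identityʳ n)) (*-identityʳ (↧ₙ x))

[↥x+k↧x]/↧x-x≡k : ∀ x k → (↥ x ℤ.+ k ℤ.* ↧ x) / ↧ₙ x ℚ.- x ≡ fromℤ k
[↥x+k↧x]/↧x-x≡k x k = trans (cong (ℚ._- x) (sym (+-fromℤ x k))) (xyx⁻¹≈y x (fromℤ k))

allFractions≥2-approximate : ∀ {S} → AllFractions≥2 S →
                             ∀ m .{{_ : NonZero m}} x → Σ ℚ λ s → S s × m ∣ ∣ ↥ (s ℚ.- x) ∣
allFractions≥2-approximate {S} S⊇ m x@(mkℚ n δ _) =
  s , S⊇ (δ , y) , subst (λ t → m ∣ ∣ ↥ t ∣) (sym s-x≡K) m∣K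
  where
  d = suc δ
  representative = representative-≥ n (2 * d) (d * m) {{m*n≢0 d m}}
  y = proj₁ representative
  Q = proj₁ (proj₂ representative)
  K = Q ℤ.* + m
  s = (+ (2 * d + y)) / d
  numerator≡ : + (2 * d + y) ≡ n ℤ.+ K ℤ.* + d
  numerator≡ = begin
    + (2 * d + y)             ≡⟨ proj₂ (proj₂ representative) ⟩
    n ℤ.+ Q ℤ.* + (d * m)     ≡⟨ cong (λ t → n ℤ.+ Q ℤ.* t) (pos-* d m) ⟩
    n ℤ.+ Q ℤ.* (+ d ℤ.* + m) ≡⟨ regroup n Q (+ d) (+ m) ⟩
    n ℤ.+ K ℤ.* + d           ∎
    where
    open ≡-Reasoning
    regroup : ∀ n Q d m → n ℤ.+ Q ℤ.* (d ℤ.* m) ≡ n ℤ.+ Q ℤ.* m ℤ.* d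
    regroup = solve-∀
  s-x≡K : s ℚ.- x ≡ fromℤ K
  s-x≡K = trans (cong (ℚ._- x) (/-cong numerator≡ refl)) ([↥x+k↧x]/↧x-x≡k x K)
  m∣K : m ∣ ∣ K ∣
  m∣K = subst (m ∣_) (sym (abs-* Q (+ m))) (n∣m*n ∣ Q ∣)

allFractions≥2⇒denseInQp : ∀ {S} → AllFractions≥2 S →
                           ∀ p .{{_ : NonZero p}} → DenseInQp p S
allFractions≥2⇒denseInQp S⊇ p x k = allFractions≥2-approximate S⊇ (p ^ k) {{m^n≢0 p k}} x

theorem3p3 : Σ Subset λ A → PositiveSet A × No3AP A × (∀ (p : ℕ) → Prime p → DenseInQp p (RatioSet A))
theorem3p3 = A , image-positive , image-no3AP ,
  λ p p-prime → allFractions≥2⇒denseInQp (ratioSet-allFractions≥2 diagonal-surjective)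
                  p {{prime⇒nonZero p-prime}}
  where open Scaling diagonal
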